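{- Let $G$ be a simple bipartite graph with stable sets $X=\{x_i\}_{i=1}^s$ and $Y=\{y_j\}_{j=1}^t$, and suppose $G\cong H_1\oplus H_2$ is a decomposition of $G$. If $G$ is edge-magic, then $S_2(G;H_1,H_2)$ is edge-magic; if $G$ is super edge-magic, then $S_2(G;H_1,H_2)$ is super edge-magic.
   Context: A decomposition $G\cong H_1\oplus H_2$ means $H_1,H_2$ are subgraphs of $G$ whose edge sets partition $E(G)$. An edge-magic labeling of a graph with $p$ vertices and $q$ edges is a bijection $f:V\cup E\to\{1,\dots,p+q\}$ such that $f(x)+f(xy)+f(y)$ is constant over all edges $xy$; it is super edge-magic if moreover $f(V)=\{1,\dots,p\}$. $S_2(G;H_1,H_2)$ is the graph with vertex set $X\cup Y\cup X'\cup Y'$, where $X'=\{x_i'\}_{i=1}^s$, $Y'=\{y_j'\}_{j=1}^t$ are new vertices, and edge set $E(G)\cup\{x_iy_j': x_iy_j\in E(H_1)\}\cup\{x_i'y_j: x_iy_j\in E(H_2)\}$. -}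

module Defs where

open import Data.Nat using (ℕ; suc; _+_; _≤_)
open import Data.Fin using (Fin; toℕ)
open import Data.Bool using (Bool; true; false; T; not; _∧_)
open import Data.Sum using (_⊎_; inj₁; inj₂)
open import Data.Product using (Σ; Σ-syntax; _×_; _,_; proj₁; proj₂)
open import Function.Bundles using (_⤖_; Bijection)
open import Relation.Binary.PropositionalEquality using (_≡_)
open import Data.Empty using (⊥)

record Graph : Set₁ where
  field
    V    : Set
    E    : Set
    ends : E → V × V

open Graph public

label : {A : Set} {N : ℕ} → (A ⤖ Fin N) → A → ℕ
label f a = suc (toℕ (Bijection.to f a))

IsMagic : (G : Graph) {N : ℕ} → ((V G ⊎ E G) ⤖ Fin N) → ℕ → Set
IsMagic G f k = (e : E G) →
  label f (inj₁ (proj₁ (ends G e))) + label f (inj₂ e) + label f (inj₁ (proj₂ (ends G e))) ≡ k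

-- Edge-magic: a bijection V ∪ E → {1,…,N} (so N = p + q necessarily) with
-- constant edge sums.
EdgeMagic : Graph → Set
EdgeMagic G = Σ[ N ∈ ℕ ] Σ[ f ∈ ((V G ⊎ E G) ⤖ Fin N) ] Σ[ k ∈ ℕ ] IsMagic G f k

-- Super edge-magic: additionally, with p = |V|, every vertex label is in
-- {1,…,p}; by injectivity this means f(V) = {1,…,p}.
SuperEdgeMagic : Graph → Set
SuperEdgeMagic G =
  Σ[ p ∈ ℕ ] (V G ⤖ Fin p) ×
  (Σ[ N ∈ ℕ ] Σ[ f ∈ ((V G ⊎ E G) ⤖ Fin N) ] Σ[ k ∈ ℕ ]
     IsMagic G f k × ((v : V G) → label f (inj₁ v) ≤ p))

BipGraph : (s t : ℕ) → (Fin s → Fin t → Bool) → Graph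
BipGraph s t adj = record
  { V    = Fin s ⊎ Fin t
  ; E    = Σ[ ij ∈ Fin s × Fin t ] T (adj (proj₁ ij) (proj₂ ij))
  ; ends = λ { ((i , j) , _) → (inj₁ i , inj₂ j) }
  }

IsDecomposition : {s t : ℕ} → (adj h1 h2 : Fin s → Fin t → Bool) → Set
IsDecomposition adj h1 h2 = ∀ i j →
  (T (h1 i j) → T (adj i j)) × (T (h2 i j) → T (adj i j)) ×
  (T (adj i j) → T (h1 i j) ⊎ T (h2 i j)) × (T (h1 i j) → T (h2 i j) → ⊥)

data S2V (s t : ℕ) : Set where
  vx  : Fin s → S2V s t
  vy  : Fin t → S2V s t
  vx' : Fin s → S2V s t
  vy' : Fin t → S2V s t

data S2E {s t : ℕ} (adj h1 h2 : Fin s → Fin t → Bool) : Set where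
  eG  : (i : Fin s) (j : Fin t) → T (adj i j) → S2E adj h1 h2
  eH1 : (i : Fin s) (j : Fin t) → T (h1 i j) → S2E adj h1 h2
  eH2 : (i : Fin s) (j : Fin t) → T (h2 i j) → S2E adj h1 h2

S2 : (s t : ℕ) → (adj h1 h2 : Fin s → Fin t → Bool) → Graph
S2 s t adj h1 h2 = record
  { V    = S2V s t
  ; E    = S2E adj h1 h2
  ; ends = λ { (eG i j _) → (vx i , vy j)
             ; (eH1 i j _) → (vx i , vy' j)
             ; (eH2 i j _) → (vx' i , vy j) }
  }

module Submission where

-- S₂(G;H₁,H₂) is a "double cover" of G: every vertex and every
-- edge of G has exactly two copies among the vertices and edges of S₂.  The
-- vertex z of G has the copies z (copy 0) and z' (copy 1); the edge xᵢyⱼ of G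
-- has the copy xᵢyⱼ itself (copy 1) and, according to whether it lies in H₁
-- or H₂, the copy xᵢyⱼ' or xᵢ'yⱼ (copy 0).  On every edge of S₂ the copy
-- numbers of its two ends and of the edge itself add up to 1.
--
-- Given a labelling f of G with values 1..N, give copy c of an element a the
-- label 2 f(a) - 1 + c.  This is a bijection onto 1..2N, every vertex label
-- stays ≤ 2p when f(V) ⊆ 1..p, and an edge sum k of G becomes 2k - 2.

open import Defs
open import Data.Nat using (ℕ; suc; _+_; _*_; _∸_; _≤_; s≤s; z≤n)
open import Data.Nat.Properties using (m+n∸n≡m; ≤-trans; ≤-reflexive; +-monoʳ-≤; *-monoˡ-≤)
open import Data.Nat.Tactic.RingSolver using (solve-∀)
open import Data.Fin using (Fin; toℕ)
  renaming (zero to 0F; suc to sucF)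
open import Data.Fin.Properties using (toℕ-combine; *↔×)
open import Data.Bool using (Bool; T)
open import Data.Bool.Properties using (T-irrelevant)
open import Data.Sum using (_⊎_; inj₁; inj₂)
open import Data.Product using (Σ-syntax; _×_; _,_; proj₁; proj₂; map₁)
open import Data.Product.Function.NonDependent.Propositional using (_×-⤖_)
open import Data.Empty using (⊥; ⊥-elim)
open import Function.Bundles using (_⤖_; _↔_; Bijection; Inverse; mk↔ₛ′)
open import Function.Properties.Inverse using (↔⇒⤖)
open import Function.Construct.Composition using (_⤖-∘_)
open import Function.Construct.Identity using (⤖-id)
open import Function.Construct.Symmetry using (↔-sym)
open import Relation.Binary.PropositionalEquality
  using (_≡_; refl; sym; cong; cong₂; module ≡-Reasoning)

index : {A : Set} {N : ℕ} → (A ⤖ Fin N) → A → ℕ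
index f a = toℕ (Bijection.to f a)

-- Doubling a labelling: if ψ identifies B with two copies of A, copy c of a
-- gets index 2 · index f a + c.  It is a bijection B ⤖ Fin (2N).
double : {A B : Set} {N : ℕ} → (A ⤖ Fin N) → (B ↔ (A × Fin 2)) → B ⤖ Fin (N * 2)
double f ψ = ↔⇒⤖ (↔-sym *↔×) ⤖-∘ ((f ×-⤖ ⤖-id (Fin 2)) ⤖-∘ ↔⇒⤖ ψ)

label-double : {A B : Set} {N : ℕ} (f : A ⤖ Fin N) (ψ : B ↔ (A × Fin 2)) (b : B) {a : A} →
  proj₁ (Inverse.to ψ b) ≡ a →
  label (double f ψ) b ≡ suc (2 * index f a + toℕ (proj₂ (Inverse.to ψ b)))
label-double f ψ b refl =
  cong suc (toℕ-combine (Bijection.to f (proj₁ (Inverse.to ψ b))) (proj₂ (Inverse.to ψ b)))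

doubled-edge-sum : ∀ a e c u v w k → suc a + suc e + suc c ≡ k → u + v + w ≡ 1 →
  suc (2 * a + u) + suc (2 * e + v) + suc (2 * c + w) ≡ k * 2 ∸ 2
doubled-edge-sum a e c u v w k refl copies = begin
  suc (2 * a + u) + suc (2 * e + v) + suc (2 * c + w) ≡⟨ regroup a e c u v w ⟩
  2 * (a + e + c) + (u + v + w) + 3                   ≡⟨ cong (λ z → 2 * (a + e + c) + z + 3) copies ⟩
  2 * (a + e + c) + 1 + 3                             ≡⟨ sym (m+n∸n≡m _ 2) ⟩
  2 * (a + e + c) + 1 + 3 + 2 ∸ 2                     ≡⟨ cong (_∸ 2) (twice a e c) ⟩
  (suc a + suc e + suc c) * 2 ∸ 2                     ∎
  where
  open ≡-Reasoning
  regroup : ∀ a e c u v w →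
    suc (2 * a + u) + suc (2 * e + v) + suc (2 * c + w) ≡ 2 * (a + e + c) + (u + v + w) + 3
  regroup = solve-∀
  twice : ∀ a e c → 2 * (a + e + c) + 1 + 3 + 2 ≡ (suc a + suc e + suc c) * 2
  twice = solve-∀

doubled-bound : ∀ a c p → suc a ≤ p → c ≤ 1 → suc (2 * a + c) ≤ p * 2
doubled-bound a c p a<p c≤1 = begin
  suc (2 * a + c) ≤⟨ s≤s (+-monoʳ-≤ (2 * a) c≤1) ⟩
  suc (2 * a + 1) ≡⟨ shift a ⟩
  suc a * 2       ≤⟨ *-monoˡ-≤ 2 a<p ⟩
  p * 2           ∎
  where
  open Data.Nat.Properties.≤-Reasoning
  shift : ∀ a → suc (2 * a + 1) ≡ suc a * 2
  shift = solve-∀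

copy≤1 : (c : Fin 2) → toℕ c ≤ 1
copy≤1 0F = z≤n
copy≤1 (sucF 0F) = s≤s z≤n

record Doubling (G H : Graph) : Set where
  field
    vertexCopy  : V H ↔ (V G × Fin 2)
    elementCopy : (V H ⊎ E H) ↔ ((V G ⊎ E G) × Fin 2)

  over : V H ⊎ E H → V G ⊎ E G
  over z = proj₁ (Inverse.to elementCopy z)

  copy : V H ⊎ E H → ℕ
  copy z = toℕ (proj₂ (Inverse.to elementCopy z))

  field
    vertexCompatible : ∀ v → Inverse.to elementCopy (inj₁ v) ≡ map₁ inj₁ (Inverse.to vertexCopy v)
    edgeOver : (e : E H) → let (x , y) = ends H e in Σ[ e₀ ∈ E G ]
      over (inj₁ x) ≡ inj₁ (proj₁ (ends G e₀)) × over (inj₂ e) ≡ inj₂ e₀ ×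
      over (inj₁ y) ≡ inj₁ (proj₂ (ends G e₀)) × copy (inj₁ x) + copy (inj₂ e) + copy (inj₁ y) ≡ 1

module _ {G H : Graph} (D : Doubling G H) where
  open Doubling D

  magic-double : {N : ℕ} (f : (V G ⊎ E G) ⤖ Fin N) {k : ℕ} →
    IsMagic G f k → IsMagic H (double f elementCopy) (k * 2 ∸ 2)
  magic-double {N} f {k} magic e
    with (x , y) ← ends H e | (e₀ , x-over , e-over , y-over , copies) ← edgeOver e =
    begin
      label g (inj₁ x) + label g (inj₂ e) + label g (inj₁ y)
        ≡⟨ cong₂ _+_ (cong₂ _+_ (label-double f elementCopy (inj₁ x) x-over)
                                 (label-double f elementCopy (inj₂ e) e-over))
                                 (label-double f elementCopy (inj₁ y) y-over) ⟩
      suc (2 * index f (inj₁ x₀) + copy (inj₁ x)) + suc (2 * index f (inj₂ e₀) + copy (inj₂ e))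
        + suc (2 * index f (inj₁ y₀) + copy (inj₁ y))
        ≡⟨ doubled-edge-sum _ _ _ _ _ _ k (magic e₀) copies ⟩
      k * 2 ∸ 2 ∎
    where
    open ≡-Reasoning
    g : (V H ⊎ E H) ⤖ Fin (N * 2)
    g = double f elementCopy
    x₀ y₀ : V G
    x₀ = proj₁ (ends G e₀)
    y₀ = proj₂ (ends G e₀)

  edgeMagic-double : EdgeMagic G → EdgeMagic H
  edgeMagic-double (N , f , k , magic) = N * 2 , double f elementCopy , k * 2 ∸ 2 , magic-double f magic

  bound-double : {N p : ℕ} (f : (V G ⊎ E G) ⤖ Fin N) →
    ((w : V G) → label f (inj₁ w) ≤ p) → (v : V H) → label (double f elementCopy) (inj₁ v) ≤ p * 2
  bound-double {p = p} f bound v =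
    ≤-trans (≤-reflexive (label-double f elementCopy (inj₁ v) (cong proj₁ (vertexCompatible v))))
      (doubled-bound _ (copy (inj₁ v)) p (bound w) (copy≤1 (proj₂ (Inverse.to elementCopy (inj₁ v)))))
    where
    w : V G
    w = proj₁ (Inverse.to vertexCopy v)

  superEdgeMagic-double : SuperEdgeMagic G → SuperEdgeMagic H
  superEdgeMagic-double (p , vertices , N , f , k , magic , bound) =
    p * 2 , double vertices vertexCopy ,
    N * 2 , double f elementCopy , k * 2 ∸ 2 , magic-double f magic , bound-double f bound

module S₂Doubling (s t : ℕ) (adj h1 h2 : Fin s → Fin t → Bool)
                  (decomposition : IsDecomposition adj h1 h2) where
  G H : Graph
  G = BipGraph s t adj
  H = S2 s t adj h1 h2

  h1⊆G : ∀ {i j} → T (h1 i j) → T (adj i j)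
  h1⊆G {i} {j} = proj₁ (decomposition i j)

  h2⊆G : ∀ {i j} → T (h2 i j) → T (adj i j)
  h2⊆G {i} {j} = proj₁ (proj₂ (decomposition i j))

  covered : ∀ {i j} → T (adj i j) → T (h1 i j) ⊎ T (h2 i j)
  covered {i} {j} = proj₁ (proj₂ (proj₂ (decomposition i j)))

  disjoint : ∀ {i j} → T (h1 i j) → T (h2 i j) → ⊥
  disjoint {i} {j} = proj₂ (proj₂ (proj₂ (decomposition i j)))

  vertexCopy : S2V s t → V G × Fin 2
  vertexCopy (vx i)  = inj₁ i , 0F
  vertexCopy (vy j)  = inj₂ j , 0F
  vertexCopy (vx' i) = inj₁ i , sucF 0F
  vertexCopy (vy' j) = inj₂ j , sucF 0F

  vertexOf : V G × Fin 2 → S2V s t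
  vertexOf (inj₁ i , 0F)      = vx i
  vertexOf (inj₂ j , 0F)      = vy j
  vertexOf (inj₁ i , sucF 0F) = vx' i
  vertexOf (inj₂ j , sucF 0F) = vy' j

  vertexCopy-vertexOf : ∀ z → vertexCopy (vertexOf z) ≡ z
  vertexCopy-vertexOf (inj₁ i , 0F)      = refl
  vertexCopy-vertexOf (inj₂ j , 0F)      = refl
  vertexCopy-vertexOf (inj₁ i , sucF 0F) = refl
  vertexCopy-vertexOf (inj₂ j , sucF 0F) = refl

  vertexOf-vertexCopy : ∀ v → vertexOf (vertexCopy v) ≡ v
  vertexOf-vertexCopy (vx i)  = refl
  vertexOf-vertexCopy (vy j)  = refl
  vertexOf-vertexCopy (vx' i) = refl
  vertexOf-vertexCopy (vy' j) = refl

  elementCopy : V H ⊎ E H → (V G ⊎ E G) × Fin 2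
  elementCopy (inj₁ v)           = map₁ inj₁ (vertexCopy v)
  elementCopy (inj₂ (eG i j p))  = inj₂ ((i , j) , p) , sucF 0F
  elementCopy (inj₂ (eH1 i j p)) = inj₂ ((i , j) , h1⊆G p) , 0F
  elementCopy (inj₂ (eH2 i j p)) = inj₂ ((i , j) , h2⊆G p) , 0F

  lowerEdge : ∀ i j → T (h1 i j) ⊎ T (h2 i j) → S2E adj h1 h2
  lowerEdge i j (inj₁ q) = eH1 i j q
  lowerEdge i j (inj₂ q) = eH2 i j q

  elementOf : (V G ⊎ E G) × Fin 2 → V H ⊎ E H
  elementOf (inj₁ w , c)                   = inj₁ (vertexOf (w , c))
  elementOf (inj₂ ((i , j) , p) , 0F)      = inj₂ (lowerEdge i j (covered p))
  elementOf (inj₂ ((i , j) , p) , sucF 0F) = inj₂ (eG i j p)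

  lowerEdge-over : ∀ {i j} (p : T (adj i j)) c →
    elementCopy (inj₂ (lowerEdge i j c)) ≡ (inj₂ ((i , j) , p) , 0F)
  lowerEdge-over {i} {j} p (inj₁ q) = cong (λ r → inj₂ ((i , j) , r) , 0F) (T-irrelevant _ p)
  lowerEdge-over {i} {j} p (inj₂ q) = cong (λ r → inj₂ ((i , j) , r) , 0F) (T-irrelevant _ p)

  -- An H₁-edge is never in H₂ and vice versa, so the choice recovers the edge.
  lowerEdge-h1 : ∀ {i j} (p : T (h1 i j)) c → lowerEdge i j c ≡ eH1 i j p
  lowerEdge-h1 {i} {j} p (inj₁ q) = cong (eH1 i j) (T-irrelevant q p)
  lowerEdge-h1 {i} {j} p (inj₂ q) = ⊥-elim (disjoint p q)

  lowerEdge-h2 : ∀ {i j} (p : T (h2 i j)) c → lowerEdge i j c ≡ eH2 i j p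
  lowerEdge-h2 {i} {j} p (inj₁ q) = ⊥-elim (disjoint q p)
  lowerEdge-h2 {i} {j} p (inj₂ q) = cong (eH2 i j) (T-irrelevant q p)

  elementCopy-elementOf : ∀ z → elementCopy (elementOf z) ≡ z
  elementCopy-elementOf (inj₁ w , c)                   = cong (map₁ inj₁) (vertexCopy-vertexOf (w , c))
  elementCopy-elementOf (inj₂ ((i , j) , p) , 0F)      = lowerEdge-over p (covered p)
  elementCopy-elementOf (inj₂ ((i , j) , p) , sucF 0F) = refl

  elementOf-elementCopy : ∀ z → elementOf (elementCopy z) ≡ z
  elementOf-elementCopy (inj₁ v)           = cong inj₁ (vertexOf-vertexCopy v)
  elementOf-elementCopy (inj₂ (eG i j p))  = refl
  elementOf-elementCopy (inj₂ (eH1 i j p)) = cong inj₂ (lowerEdge-h1 p (covered (h1⊆G p)))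
  elementOf-elementCopy (inj₂ (eH2 i j p)) = cong inj₂ (lowerEdge-h2 p (covered (h2⊆G p)))

  doubling : Doubling G H
  doubling = record
    { vertexCopy       = mk↔ₛ′ vertexCopy vertexOf vertexCopy-vertexOf vertexOf-vertexCopy
    ; elementCopy      = mk↔ₛ′ elementCopy elementOf elementCopy-elementOf elementOf-elementCopy
    ; vertexCompatible = λ _ → refl
    -- Each edge of S₂ lies over the corresponding edge xᵢyⱼ of G; the copy
    -- numbers are (0,1,0), (0,0,1) and (1,0,0) for G-, H₁- and H₂-edges.
    ; edgeOver         = λ where
        (eG i j p)  → ((i , j) , p) , refl , refl , refl , refl
        (eH1 i j p) → ((i , j) , h1⊆G p) , refl , refl , refl , refl
        (eH2 i j p) → ((i , j) , h2⊆G p) , refl , refl , refl , refl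
    }

theorem3p1 : (s t : ℕ) (adj h1 h2 : Fin s → Fin t → Bool) →
    IsDecomposition adj h1 h2 →
    (EdgeMagic (BipGraph s t adj) → EdgeMagic (S2 s t adj h1 h2)) ×
    (SuperEdgeMagic (BipGraph s t adj) → SuperEdgeMagic (S2 s t adj h1 h2))
theorem3p1 s t adj h1 h2 decomposition =
  edgeMagic-double doubling , superEdgeMagic-double doubling
  where open S₂Doubling s t adj h1 h2 decomposition using (doubling)
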